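{- Let $G=(V,E)$ and the algorithm be as described in the context, executed under the distributed adversarial daemon. For every edge $(i,j)\in E$ and every execution, there are at most three steps of the execution in which an $i,j$-move is performed.
   Context: Let $G=(V,E)$ be a finite simple undirected graph; each node is a process and $N(i)$ denotes the set of neighbours of $i$. Each process has an identifier from a totally ordered set; identifiers of any two distinct processes at distance at most $2$ are distinct, and comparisons such as $j>i$ between processes are comparisons of their identifiers. Each process $i$ holds variables $m_i\in\{\text{true},\text{false}\}$ and $p_i\in\{null\}\cup N(i)$; a configuration is an assignment of values to all these variables. Define the predicate $PRmarried(i)\equiv \exists j\in N(i): (p_i=j \text{ and } p_j=i)$. The algorithm consists of the following four guarded rules for each process $i$ (a rule is enabled at $i$ if its guard holds; at most one rule is enabled at a process at any time): Update: if $m_i\neq PRmarried(i)$ then $m_i:=PRmarried(i)$. Marriage: if $m_i=PRmarried(i)$ and $p_i=null$ and there is $j\in N(i)$ with $p_j=i$, then $p_i:=j$ (for such a $j$). Seduction: if $m_i=PRmarried(i)$ and $p_i=null$ and $p_k\neq i$ for all $k\in N(i)$ and there is $j\in N(i)$ with $p_j=null$, $j>i$ and $m_j=\text{false}$, then $p_i:=\max\{j\in N(i): p_j=null,\ j>i,\ m_j=\text{false}\}$. Abandonment: if $m_i=PRmarried(i)$ and $p_i=j\neq null$ and $p_j\neq i$ and ($m_j=\text{true}$ or $j\le i$), then $p_i:=null$. A process is eligible if some rule is enabled at it. Under the distributed adversarial daemon, a step from a configuration $C$ consists of an arbitrary nonempty subset of the processes eligible in $C$ each executing its enabled rule, all guards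 and assignments being evaluated in $C$ (simultaneous execution); an execution is a maximal sequence of configurations, starting from an arbitrary configuration, each obtained from the previous one by a step. The execution of a rule by a process is a move. For an edge $(i,j)$, an $i,j$-move is a Marriage or Seduction move by $i$ that sets $p_i:=j$, or an Abandonment move by $i$ executed while $p_i=j$, or symmetrically a Marriage or Seduction move by $j$ that sets $p_j:=i$, or an Abandonment move by $j$ executed while $p_j=i$. -}

module Defs where

open import Level using (_⊔_)
open import Data.Nat using (ℕ; suc)
open import Data.Fin using (Fin)
open import Data.Bool using (Bool; true; false)
open import Data.Maybe using (Maybe; just; nothing)
open import Data.Product using (Σ; ∃; _×_; _,_)
open import Data.Sum using (_⊎_)
open import Data.Empty using (⊥)
open import Relation.Nullary using (¬_)
open import Relation.Binary.PropositionalEquality using (_≡_; _≢_)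
open import Relation.Binary.Bundles using (StrictTotalOrder)

record Graph (n : ℕ) : Set where
  field
    E      : Fin n → Fin n → Bool
    E-sym  : ∀ i j → E i j ≡ E j i
    E-irr  : ∀ i → E i i ≡ false

  Adj : Fin n → Fin n → Set
  Adj i j = E i j ≡ true

open Graph public

LocallyUnique : ∀ {n a ℓ₁ ℓ₂} (G : Graph n) (O : StrictTotalOrder a ℓ₁ ℓ₂)
                (ident : Fin n → StrictTotalOrder.Carrier O) → Set ℓ₁
LocallyUnique {n} G O ident =
  ∀ (i j : Fin n) → i ≢ j →
    (Adj G i j ⊎ Σ (Fin n) (λ k → Adj G i k × Adj G k j)) →
    ¬ (ident i ≈ ident j)
  where open StrictTotalOrder O

module Algorithm {n : ℕ} (G : Graph n) {a ℓ₁ ℓ₂ : Level.Level}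
                 (O : StrictTotalOrder a ℓ₁ ℓ₂)
                 (ident : Fin n → StrictTotalOrder.Carrier O) where

  open StrictTotalOrder O using (_<_; _≈_)

  _≺_ : Fin n → Fin n → Set ℓ₂
  i ≺ j = ident i < ident j

  _≼_ : Fin n → Fin n → Set (ℓ₁ ⊔ ℓ₂)
  j ≼ i = (ident j < ident i) ⊎ (ident j ≈ ident i)

  -- A configuration: m_i ∈ Bool, p_i ∈ {null} ∪ N(i) (null = nothing).
  record Config : Set where
    field
      m     : Fin n → Bool
      p     : Fin n → Maybe (Fin n)
      p-nbr : ∀ i j → p i ≡ just j → Adj G i j

  open Config public

  PRmarried : Config → Fin n → Set
  PRmarried C i = Σ (Fin n) λ j → Adj G i j × p C i ≡ just j × p C j ≡ just i

  MEq : Config → Fin n → Set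
  MEq C i = (m C i ≡ true → PRmarried C i) × (PRmarried C i → m C i ≡ true)

  Cand : Config → Fin n → Fin n → Set ℓ₂
  Cand C i j = Adj G i j × p C j ≡ nothing × i ≺ j × m C j ≡ false

  -- Rule C i b q : process i, in configuration C, executes an enabled rule
  -- whose effect is to set (m_i , p_i) := (b , q).
  data Rule (C : Config) (i : Fin n) : Bool → Maybe (Fin n) → Set (ℓ₁ ⊔ ℓ₂) where
    update      : ¬ MEq C i → (b : Bool) →
                  (b ≡ true → PRmarried C i) → (PRmarried C i → b ≡ true) →
                  Rule C i b (p C i)
    marriage    : MEq C i → p C i ≡ nothing →
                  (j : Fin n) → Adj G i j → p C j ≡ just i →
                  Rule C i (m C i) (just j)
    seduction   : MEq C i → p C i ≡ nothing →
                  (∀ k → Adj G i k → p C k ≢ just i) →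
                  (j : Fin n) → Cand C i j →
                  (∀ k → Cand C i k → (k ≡ j) ⊎ (k ≺ j)) →
                  Rule C i (m C i) (just j)
    abandonment : MEq C i → (j : Fin n) → p C i ≡ just j → p C j ≢ just i →
                  (m C j ≡ true ⊎ j ≼ i) →
                  Rule C i (m C i) nothing

  Eligible : Config → Fin n → Set (ℓ₁ ⊔ ℓ₂)
  Eligible C i = Σ Bool λ b → Σ (Maybe (Fin n)) λ q → Rule C i b q

  MoveFor : ∀ {C i b q} → Rule C i b q → Fin n → Set
  MoveFor (update _ _ _ _)            y = ⊥
  MoveFor (marriage _ _ j _ _)        y = j ≡ y
  MoveFor (seduction _ _ _ j _ _)     y = j ≡ y
  MoveFor (abandonment _ j _ _ _)     y = j ≡ y

  -- Either a genuine step of the distributed daemon (S nonempty, each process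
  -- of S executes its enabled rule, simultaneously, all other processes keep
  -- their state), or, if C is terminal (no eligible process), the execution
  -- has ended; we then just repeat C (a padding that performs no move).
  data Transition (C : Config) (S : Fin n → Bool) (C' : Config) : Set (ℓ₁ ⊔ ℓ₂) where
    step : Σ (Fin n) (λ i → S i ≡ true) →
           (moves : ∀ i → S i ≡ true → Rule C i (m C' i) (p C' i)) →
           (∀ i → S i ≡ false → m C' i ≡ m C i × p C' i ≡ p C i) →
           Transition C S C'
    stop : (∀ i → ¬ Eligible C i) →
           (∀ i → m C' i ≡ m C i × p C' i ≡ p C i) →
           Transition C S C'

  -- A maximal execution (finite executions padded with the final configuration).
  record Execution : Set (ℓ₁ ⊔ ℓ₂) where
    field
      conf  : ℕ → Config
      act   : ℕ → Fin n → Bool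
      trans : ∀ t → Transition (conf t) (act t) (conf (suc t))

  open Execution public

  IJMoveIn : ∀ {C S C'} → Transition C S C' → Fin n → Fin n → Set
  IJMoveIn {S = S} (step _ mv _) i j =
    Σ (S i ≡ true) (λ h → MoveFor (mv i h) j) ⊎ Σ (S j ≡ true) (λ h → MoveFor (mv j h) i)
  IJMoveIn (stop _ _) i j = ⊥

  IJMoveAt : Execution → ℕ → Fin n → Fin n → Set
  IJMoveAt X t i j = IJMoveIn (trans X t) i j

module Submission where

-- Fix the edge and call i its endpoint with the smaller identifier. An i,j-move flips one of
-- the bits "p_i = j" and "p_j = i"; together with m_j and "j is married" they form a snapshot
-- of the edge. Inspecting the four rules shows which snapshot transitions a step can make:
-- a mutual marriage is never undone, j cannot seduce i, i seduces j only if j is free and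
-- unflagged, i abandons j only if m_j holds, and j abandons i only while m_j is false. These
-- constraints make a potential with values in {0,…,3} non-increasing along an
-- execution and strictly decreasing at every step containing an i,j-move.

open import Defs
open import Data.Nat using (ℕ; _<_)
open import Data.Fin using (Fin)
open import Data.Product using (_×_)
open import Relation.Nullary using (¬_)
open import Relation.Binary.Bundles using (StrictTotalOrder)

open import Level using (Level; _⊔_)
open import Data.Nat using (_≤_; _≤′_; ≤′-refl; ≤′-step; z≤n; s≤s)
open import Data.Nat.Properties using (≤-refl; ≤-trans; ≤-<-trans; <⇒≤; <⇒≱; ≤⇒≤′)
open import Data.Fin.Properties using (any?) renaming (_≟_ to _≟ᶠ_)
open import Data.Bool using (Bool; true; false)
open import Data.Bool.Properties using () renaming (_≟_ to _≟ᵇ_)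
open import Data.Maybe using (Maybe; just; nothing)
open import Data.Maybe.Properties using (just-injective) renaming (≡-dec to ≡-decᵐ)
open import Data.Product using (_,_; proj₁; proj₂; map₂)
open import Data.Sum using (_⊎_; inj₁; inj₂) renaming (map₂ to ⊎-map₂)
open import Data.Empty using (⊥-elim)
open import Relation.Nullary using (Dec; yes; no; does; _×-dec_)
open import Relation.Nullary.Decidable using (dec-true; dec-false)
open import Relation.Binary.PropositionalEquality using (_≡_; _≢_; refl; sym; trans; cong)
open import Relation.Binary.Definitions using (tri<; tri≈; tri>)

adjacent-distinct : ∀ {n} (G : Graph n) {i j : Fin n} → Adj G i j → i ≢ j
adjacent-distinct G {i} adj refl with trans (sym adj) (E-irr G i)
... | ()

record Snapshot : Set where
  constructor snap
  field
    i↦j j↦i mⱼ j-married : Bool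

open Snapshot

record Successor (s s' : Snapshot) : Set where
  field
    married-stays      : j-married s ≡ true → j-married s' ≡ true
    flag-needs-reason  : mⱼ s' ≡ true → mⱼ s ≡ true ⊎ j-married s ≡ true
    i-courts-free-j    : i↦j s ≡ false → i↦j s' ≡ true → j↦i s ≡ false →
                         mⱼ s ≡ false × j-married s ≡ false
    i-leaves-flagged-j : i↦j s ≡ true → i↦j s' ≡ false → mⱼ s ≡ true × j↦i s ≡ false
    j-answers-i        : j↦i s ≡ false → j↦i s' ≡ true →
                         i↦j s ≡ true × mⱼ s ≡ false × j-married s ≡ false
    j-leaves-i         : j↦i s ≡ true → j↦i s' ≡ false →
                         i↦j s ≡ false × mⱼ s ≡ false × mⱼ s' ≡ false

open Successor

-- An upper bound on the number of i,j-moves still to come.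
potential : Snapshot → ℕ
potential (snap true  true  _     _)     = 0
potential (snap false true  _     _)     = 3
potential (snap false false _     true)  = 0
potential (snap false false _     false) = 2
potential (snap true  false true  false) = 3
potential (snap true  false true  true)  = 1
potential (snap true  false false _)     = 1

potential≤3 : ∀ s → potential s ≤ 3
potential≤3 (snap true  true  _     _)     = z≤n
potential≤3 (snap false true  _     _)     = ≤-refl
potential≤3 (snap false false _     true)  = z≤n
potential≤3 (snap false false _     false) = s≤s (s≤s z≤n)
potential≤3 (snap true  false true  false) = ≤-refl
potential≤3 (snap true  false true  true)  = s≤s z≤n
potential≤3 (snap true  false false _)     = s≤s z≤n

potential-courting-positive : ∀ m w → 0 < potential (snap true false m w)
potential-courting-positive true  false = s≤s z≤n
potential-courting-positive true  true  = s≤s z≤n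
potential-courting-positive false _     = s≤s z≤n

PointersChanged : Snapshot → Snapshot → Set
PointersChanged s s' = (i↦j s , j↦i s) ≢ (i↦j s' , j↦i s')

potential-stable : ∀ {s s'} → Successor s s' → i↦j s ≡ i↦j s' → j↦i s ≡ j↦i s' →
                   potential s' ≤ potential s
potential-stable {snap true  true  _ _}     {snap _ _ _ _}         _ refl refl = z≤n
potential-stable {snap false true  _ _}     {snap _ _ _ _}         _ refl refl = ≤-refl
potential-stable {snap false false _ true}  {snap _ _ _ w'}        σ refl refl
  rewrite married-stays σ refl = z≤n
potential-stable {snap false false _ false} {snap _ _ _ true}      _ refl refl = z≤n
potential-stable {snap false false _ false} {snap _ _ _ false}     _ refl refl = ≤-refl
potential-stable {snap true  false m w}     {snap _ _ false _}     _ refl refl =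
  potential-courting-positive m w
potential-stable {snap true  false m w}     {snap _ _ true true}   _ refl refl =
  potential-courting-positive m w
potential-stable {snap true  false m true}  {snap _ _ true false}  σ refl refl
  with married-stays σ refl
... | ()
potential-stable {snap true  false m false} {snap _ _ true false}  σ refl refl
  with flag-needs-reason σ refl
... | inj₁ refl = ≤-refl

potential-drops : ∀ {s s'} → Successor s s' → PointersChanged s s' → potential s' < potential s
potential-drops {snap true  true  _ _}     {snap true  true  _ _}     _ ne = ⊥-elim (ne refl)
potential-drops {snap false true  _ _}     {snap false true  _ _}     _ ne = ⊥-elim (ne refl)
potential-drops {snap false false _ _}     {snap false false _ _}     _ ne = ⊥-elim (ne refl)
potential-drops {snap true  false _ _}     {snap true  false _ _}     _ ne = ⊥-elim (ne refl)
potential-drops {snap true  true  _ _}     {snap true  false _ _}     σ _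
  with j-leaves-i σ refl refl
... | () , _
potential-drops {snap true  true  _ _}     {snap false _     _ _}     σ _
  with i-leaves-flagged-j σ refl refl
... | _ , ()
potential-drops {snap false true  _ _}     {snap true  true  _ _}     _ _ = s≤s z≤n
potential-drops {snap false true  _ _}     {snap true  false false _} _ _ = s≤s (s≤s z≤n)
potential-drops {snap false true  _ _}     {snap true  false true _}  σ _
  with j-leaves-i σ refl refl
... | _ , _ , ()
potential-drops {snap false true  _ _}     {snap false false _ true}  _ _ = s≤s z≤n
potential-drops {snap false true  _ _}     {snap false false _ false} _ _ = s≤s (s≤s (s≤s z≤n))
potential-drops {snap false false _ _}     {snap _     true  _ _}     σ _
  with j-answers-i σ refl refl
... | () , _
potential-drops {snap false false _ _}     {snap true  false false _} σ _
  with i-courts-free-j σ refl refl refl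
... | refl , refl = s≤s (s≤s z≤n)
potential-drops {snap false false _ _}     {snap true  false true _}  σ _
  with i-courts-free-j σ refl refl refl | flag-needs-reason σ refl
... | refl , refl | inj₁ ()
... | refl , refl | inj₂ ()
potential-drops {snap true  false m w}     {snap true  true  _ _}     _ _ =
  potential-courting-positive m w
potential-drops {snap true  false _ _}     {snap false true  _ _}     σ _
  with i-leaves-flagged-j σ refl refl | j-answers-i σ refl refl
... | refl , _ | _ , () , _
potential-drops {snap true  false m true}  {snap false false _ _}     σ _
  rewrite married-stays σ refl = potential-courting-positive m true
potential-drops {snap true  false _ false} {snap false false _ true}  σ _
  with i-leaves-flagged-j σ refl refl
... | refl , _ = s≤s z≤n
potential-drops {snap true  false _ false} {snap false false _ false} σ _
  with i-leaves-flagged-j σ refl refl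
... | refl , _ = s≤s (s≤s (s≤s z≤n))

potential-step : ∀ {s s'} → Successor s s' → potential s' ≤ potential s
potential-step {s} {s'} σ with i↦j s ≟ᵇ i↦j s' | j↦i s ≟ᵇ j↦i s'
... | yes P≡ | yes Q≡ = potential-stable σ P≡ Q≡
... | no P≢  | _      = <⇒≤ (potential-drops σ λ eq → P≢ (cong proj₁ eq))
... | _      | no Q≢  = <⇒≤ (potential-drops σ λ eq → Q≢ (cong proj₂ eq))

does-true : ∀ {a} {A : Set a} (a? : Dec A) → does a? ≡ true → A
does-true (yes a) _ = a

does-false : ∀ {a} {A : Set a} (a? : Dec A) → does a? ≡ false → ¬ A
does-false (no ¬a) _ = ¬a

does-differ : ∀ {a b} {A : Set a} {B : Set b} (a? : Dec A) (b? : Dec B) →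
              (A × ¬ B) ⊎ (¬ A × B) → does a? ≢ does b?
does-differ (yes _) (yes b) (inj₁ (_ , ¬b)) _ = ¬b b
does-differ (yes a) (yes _) (inj₂ (¬a , _)) _ = ¬a a
does-differ (no ¬a) (no _)  (inj₁ (a , _))  _ = ¬a a
does-differ (no _)  (no ¬b) (inj₂ (_ , b))  _ = ¬b b
does-differ (yes _) (no _)  _ ()
does-differ (no _)  (yes _) _ ()

module Moves {n : ℕ} (G : Graph n) {a ℓ₁ ℓ₂ : Level} (O : StrictTotalOrder a ℓ₁ ℓ₂)
             (ident : Fin n → StrictTotalOrder.Carrier O) where

  open Algorithm G O ident hiding (trans)
  open StrictTotalOrder O using (asym; irrefl; module Eq)

  data Acts (C : Config) (x : Fin n) : Bool → Maybe (Fin n) → Set (ℓ₁ ⊔ ℓ₂) where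
    idle  : Acts C x (m C x) (p C x)
    moves : ∀ {b q} → Rule C x b q → Acts C x b q

  acts : ∀ {C S C'} → Transition C S C' → ∀ x → Acts C x (m C' x) (p C' x)
  acts {S = S} (step _ rule same) x with S x in active
  ... | true  = moves (rule x active)
  ... | false rewrite proj₁ (same x active) | proj₂ (same x active) = idle
  acts (stop _ same) x rewrite proj₁ (same x) | proj₂ (same x) = idle

  _≟ᵖ_ : (q q' : Maybe (Fin n)) → Dec (q ≡ q')
  _≟ᵖ_ = ≡-decᵐ _≟ᶠ_

  married? : ∀ C x → Dec (PRmarried C x)
  married? C x = any? λ k → (E G x k ≟ᵇ true) ×-dec (p C x ≟ᵖ just k) ×-dec (p C k ≟ᵖ just x)

  null-not-just : ∀ {q : Maybe (Fin n)} {y} → q ≡ nothing → q ≢ just y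
  null-not-just refl ()

  unmarried-if-null : ∀ {C x} → p C x ≡ nothing → ¬ PRmarried C x
  unmarried-if-null null (_ , _ , x↦k , _) = null-not-just null x↦k

  unmarried-if-unanswered : ∀ {C x y} → p C x ≡ just y → p C y ≢ just x → ¬ PRmarried C x
  unmarried-if-unanswered x↦y unanswered (k , _ , x↦k , k↦x)
    with just-injective (trans (sym x↦y) x↦k)
  ... | refl = unanswered k↦x

  unflagged : ∀ {C x} → MEq C x → ¬ PRmarried C x → m C x ≡ false
  unflagged {C} {x} (sound , _) unmarried with m C x
  ... | true  = ⊥-elim (unmarried (sound refl))
  ... | false = refl

  mutual-pointer-kept : ∀ {C x y b q} → p C x ≡ just y → p C y ≡ just x → Acts C x b q → q ≡ just y
  mutual-pointer-kept x↦y _ idle = x↦y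
  mutual-pointer-kept x↦y _ (moves (update _ _ _ _)) = x↦y
  mutual-pointer-kept x↦y _ (moves (marriage _ null _ _ _)) = ⊥-elim (null-not-just null x↦y)
  mutual-pointer-kept x↦y _ (moves (seduction _ null _ _ _ _)) = ⊥-elim (null-not-just null x↦y)
  mutual-pointer-kept x↦y y↦x (moves (abandonment _ _ x↦k unanswered _))
    with just-injective (trans (sym x↦y) x↦k)
  ... | refl = ⊥-elim (unanswered y↦x)

  married-stays-married : ∀ {C S C'} → Transition C S C' → ∀ x → PRmarried C x → PRmarried C' x
  married-stays-married τ x (k , adj , x↦k , k↦x) =
    k , adj , mutual-pointer-kept x↦k k↦x (acts τ x) , mutual-pointer-kept k↦x x↦k (acts τ k)

  flag-raised-only-if-married : ∀ {C x b q} → Acts C x b q → b ≡ true → m C x ≡ true ⊎ PRmarried C x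
  flag-raised-only-if-married idle raised = inj₁ raised
  flag-raised-only-if-married (moves (update _ _ married _)) raised = inj₂ (married raised)
  flag-raised-only-if-married (moves (marriage _ _ _ _ _)) raised = inj₁ raised
  flag-raised-only-if-married (moves (seduction _ _ _ _ _ _)) raised = inj₁ raised
  flag-raised-only-if-married (moves (abandonment _ _ _ _ _)) raised = inj₁ raised

  lower-not-above : ∀ {x y} → x ≺ y → ¬ (y ≼ x)
  lower-not-above x≺y (inj₁ y≺x) = asym x≺y y≺x
  lower-not-above x≺y (inj₂ y≈x) = irrefl (Eq.sym y≈x) x≺y

  courted-is-free : ∀ {C x y b q} → Acts C x b q → p C x ≢ just y → q ≡ just y → p C y ≢ just x →
                    m C y ≡ false × p C y ≡ nothing
  courted-is-free idle                      ¬x↦y x↦y _ = ⊥-elim (¬x↦y x↦y)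
  courted-is-free (moves (update _ _ _ _))  ¬x↦y x↦y _ = ⊥-elim (¬x↦y x↦y)
  courted-is-free (moves (marriage _ _ _ _ y↦x)) _ refl ¬y↦x = ⊥-elim (¬y↦x y↦x)
  courted-is-free (moves (seduction _ _ _ _ (_ , y-null , _ , y-unflagged) _)) _ refl _ =
    y-unflagged , y-null
  courted-is-free (moves (abandonment _ _ _ _ _)) _ () _

  left-higher-is-flagged : ∀ {C x y b q} → Acts C x b q → x ≺ y → p C x ≡ just y → q ≢ just y →
                           m C y ≡ true × p C y ≢ just x
  left-higher-is-flagged idle                     _ x↦y ¬x↦y = ⊥-elim (¬x↦y x↦y)
  left-higher-is-flagged (moves (update _ _ _ _)) _ x↦y ¬x↦y = ⊥-elim (¬x↦y x↦y)
  left-higher-is-flagged (moves (marriage _ null _ _ _)) _ x↦y _ = ⊥-elim (null-not-just null x↦y)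
  left-higher-is-flagged (moves (seduction _ null _ _ _ _)) _ x↦y _ = ⊥-elim (null-not-just null x↦y)
  left-higher-is-flagged (moves (abandonment _ _ x↦k unanswered reason)) x≺y x↦y _
    with just-injective (trans (sym x↦y) x↦k) | reason
  ... | refl | inj₁ flagged = flagged , unanswered
  ... | refl | inj₂ y≼x     = ⊥-elim (lower-not-above x≺y y≼x)

  answer-to-lower-is-marriage : ∀ {C x y b q} → Acts C y b q → x ≺ y → p C y ≢ just x → q ≡ just x →
                                p C x ≡ just y × m C y ≡ false × p C y ≡ nothing
  answer-to-lower-is-marriage idle                     _ ¬y↦x y↦x = ⊥-elim (¬y↦x y↦x)
  answer-to-lower-is-marriage (moves (update _ _ _ _)) _ ¬y↦x y↦x = ⊥-elim (¬y↦x y↦x)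
  answer-to-lower-is-marriage {C} {y = y} (moves (marriage meq null _ _ x↦y)) _ _ refl =
    x↦y , unflagged {C} {y} meq (unmarried-if-null {C} null) , null
  answer-to-lower-is-marriage (moves (seduction _ _ _ _ (_ , _ , y≺x , _) _)) x≺y _ refl =
    ⊥-elim (asym x≺y y≺x)
  answer-to-lower-is-marriage (moves (abandonment _ _ _ _ _)) _ _ ()

  abandoner-is-unflagged : ∀ {C x y b q} → Acts C y b q → p C y ≡ just x → q ≢ just x →
                           p C x ≢ just y × m C y ≡ false × b ≡ false
  abandoner-is-unflagged idle                     y↦x ¬y↦x = ⊥-elim (¬y↦x y↦x)
  abandoner-is-unflagged (moves (update _ _ _ _)) y↦x ¬y↦x = ⊥-elim (¬y↦x y↦x)
  abandoner-is-unflagged (moves (marriage _ null _ _ _)) y↦x _ = ⊥-elim (null-not-just null y↦x)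
  abandoner-is-unflagged (moves (seduction _ null _ _ _ _)) y↦x _ = ⊥-elim (null-not-just null y↦x)
  abandoner-is-unflagged {C} {y = y} (moves (abandonment meq _ y↦k unanswered _)) y↦x _
    with just-injective (trans (sym y↦x) y↦k)
  ... | refl = unanswered , y-unflagged , y-unflagged
    where y-unflagged = unflagged {C} {y} meq (unmarried-if-unanswered {C} y↦k unanswered)

  move-flips-pointer : ∀ {C x y b q} (r : Rule C x b q) → MoveFor r y →
                       (p C x ≡ just y × q ≢ just y) ⊎ (p C x ≢ just y × q ≡ just y)
  move-flips-pointer (marriage _ null _ _ _) refl = inj₂ (null-not-just null , refl)
  move-flips-pointer (seduction _ null _ _ _ _) refl = inj₂ (null-not-just null , refl)
  move-flips-pointer (abandonment _ _ x↦y _ _) refl = inj₁ (x↦y , λ ())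

  ij-move-sym : ∀ {C S C' x y} (τ : Transition C S C') → IJMoveIn τ x y → IJMoveIn τ y x
  ij-move-sym (step _ _ _) (inj₁ move) = inj₂ move
  ij-move-sym (step _ _ _) (inj₂ move) = inj₁ move

  module Edge (i j : Fin n) (i≺j : i ≺ j) where

    snapshot : Config → Snapshot
    snapshot C = snap (does (p C i ≟ᵖ just j)) (does (p C j ≟ᵖ just i)) (m C j) (does (married? C j))

    successor : ∀ {C S C'} → Transition C S C' → Successor (snapshot C) (snapshot C')
    successor {C} {S} {C'} τ = record
      { married-stays      = λ married →
          dec-true (married? C' j) (married-stays-married τ j (does-true (married? C j) married))
      ; flag-needs-reason  = λ raised →
          ⊎-map₂ (dec-true (married? C j)) (flag-raised-only-if-married (acts τ j) raised)
      ; i-courts-free-j    = λ ¬i↦j i↦j′ ¬j↦i →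
          map₂ (λ null → dec-false (married? C j) (unmarried-if-null {C} null))
               (courted-is-free (acts τ i) (does-false (p C i ≟ᵖ _) ¬i↦j)
                  (does-true (p C' i ≟ᵖ _) i↦j′) (does-false (p C j ≟ᵖ _) ¬j↦i))
      ; i-leaves-flagged-j = λ i↦j ¬i↦j′ →
          map₂ (dec-false (p C j ≟ᵖ _))
               (left-higher-is-flagged (acts τ i) i≺j (does-true (p C i ≟ᵖ _) i↦j)
                  (does-false (p C' i ≟ᵖ _) ¬i↦j′))
      ; j-answers-i        = λ ¬j↦i j↦i′ →
          let (i↦j , unflagged , null) = answer-to-lower-is-marriage (acts τ j) i≺j
                 (does-false (p C j ≟ᵖ _) ¬j↦i) (does-true (p C' j ≟ᵖ _) j↦i′)
          in dec-true (p C i ≟ᵖ _) i↦j , unflagged , dec-false (married? C j) (unmarried-if-null {C} null)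
      ; j-leaves-i         = λ j↦i ¬j↦i′ →
          let (¬i↦j , unflagged , unflagged′) = abandoner-is-unflagged (acts τ j)
                 (does-true (p C j ≟ᵖ _) j↦i) (does-false (p C' j ≟ᵖ _) ¬j↦i′)
          in dec-false (p C i ≟ᵖ _) ¬i↦j , unflagged , unflagged′
      }

    ij-move-changes-pointers : ∀ {C S C'} (τ : Transition C S C') → IJMoveIn τ i j →
                               PointersChanged (snapshot C) (snapshot C')
    ij-move-changes-pointers (step _ rule _) (inj₁ (active , move)) same =
      does-differ (_ ≟ᵖ _) (_ ≟ᵖ _) (move-flips-pointer (rule i active) move) (cong proj₁ same)
    ij-move-changes-pointers (step _ rule _) (inj₂ (active , move)) same =
      does-differ (_ ≟ᵖ _) (_ ≟ᵖ _) (move-flips-pointer (rule j active) move) (cong proj₂ same)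

    module _ (X : Execution) where

      φ : ℕ → ℕ
      φ t = potential (snapshot (conf X t))

      φ-antitone : ∀ {s s'} → s ≤′ s' → φ s' ≤ φ s
      φ-antitone ≤′-refl        = ≤-refl
      φ-antitone (≤′-step s≤s') = ≤-trans (potential-step (successor (Execution.trans X _))) (φ-antitone s≤s')

      φ-drops-after-move : ∀ {s s'} → s < s' → IJMoveAt X s i j → φ s' < φ s
      φ-drops-after-move {s} s<s' move =
        ≤-<-trans (φ-antitone (≤⇒≤′ s<s'))
          (potential-drops (successor τ) (ij-move-changes-pointers τ move))
        where τ = Execution.trans X s

      no-four-moves : ∀ t₁ t₂ t₃ t₄ → t₁ < t₂ → t₂ < t₃ → t₃ < t₄ →
                      ¬ (IJMoveAt X t₁ i j × IJMoveAt X t₂ i j × IJMoveAt X t₃ i j × IJMoveAt X t₄ i j)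
      no-four-moves t₁ t₂ t₃ t₄ t₁<t₂ t₂<t₃ t₃<t₄ (move₁ , move₂ , move₃ , move₄) =
        <⇒≱ 3<φ₁ (potential≤3 (snapshot (conf X t₁)))
        where
        3<φ₁ : 3 < φ t₁
        3<φ₁ = ≤-<-trans (≤-<-trans (≤-<-trans (≤-<-trans z≤n
                 (φ-drops-after-move ≤-refl move₄))
                 (φ-drops-after-move t₃<t₄ move₃))
                 (φ-drops-after-move t₂<t₃ move₂))
                 (φ-drops-after-move t₁<t₂ move₁)

lemma6 : ∀ {n a ℓ₁ ℓ₂} (G : Graph n) (O : StrictTotalOrder a ℓ₁ ℓ₂)
           (ident : Fin n → StrictTotalOrder.Carrier O) →
           LocallyUnique G O ident →
           (i j : Fin n) → Adj G i j →
           (X : Algorithm.Execution G O ident) →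
           (t₁ t₂ t₃ t₄ : ℕ) → t₁ < t₂ → t₂ < t₃ → t₃ < t₄ →
           ¬ (Algorithm.IJMoveAt G O ident X t₁ i j ×
              Algorithm.IJMoveAt G O ident X t₂ i j ×
              Algorithm.IJMoveAt G O ident X t₃ i j ×
              Algorithm.IJMoveAt G O ident X t₄ i j)
lemma6 G O ident unique i j adj X t₁ t₂ t₃ t₄ t₁<t₂ t₂<t₃ t₃<t₄ (move₁ , move₂ , move₃ , move₄)
  with StrictTotalOrder.compare O (ident i) (ident j)
... | tri< i≺j _ _ =
  Edge.no-four-moves i j i≺j X t₁ t₂ t₃ t₄ t₁<t₂ t₂<t₃ t₃<t₄ (move₁ , move₂ , move₃ , move₄)
  where open Moves G O ident
... | tri≈ _ i≈j _ = unique i j (adjacent-distinct G adj) (inj₁ adj) i≈j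
... | tri> _ _ j≺i =
  Edge.no-four-moves j i j≺i X t₁ t₂ t₃ t₄ t₁<t₂ t₂<t₃ t₃<t₄
    (swap move₁ , swap move₂ , swap move₃ , swap move₄)
  where
  open Moves G O ident
  swap : ∀ {t} → Algorithm.IJMoveAt G O ident X t i j → Algorithm.IJMoveAt G O ident X t j i
  swap {t} = ij-move-sym (Algorithm.Execution.trans X t)
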